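{- Let $n\geq k\geq 2$ be integers. Then $$e^{(k)}_{n}=\frac{1}{2(2k)^{k}-(k+1)^{k+1}}\sum_{j=0}^{k-1}(nA_{j}+B_{j})F_{n+j}^{(k)},$$ where for $0\leq j\leq k-1$, $$A_{j}=(2k)^{k}-k(k+1)^{k}+(k-1)(k+1)^{j}(2k)^{k-j-1},$$ $$B_{j}=(2k)^{k-j-1}(k+1)^{j}\left(3k+(k-1)j-1\right)-k(k+1)^{k}.$$
   Context: For $n\geq 1$ and $k\geq 2$, the hypercube $Q_n$ is the graph whose vertices are the binary strings of length $n$, two strings adjacent iff they differ in exactly one coordinate. The $k$-th order Fibonacci cube $\Gamma^{(k)}_n$ is the subgraph of $Q_n$ induced by the binary strings of length $n$ that do not contain $k$ consecutive 1s. Let $e^{(k)}_n=|E(\Gamma^{(k)}_n)|$ denote its number of edges. The $k$-th order Fibonacci numbers are defined by $F_0^{(k)}=\cdots=F_{k-2}^{(k)}=0$, $F_{k-1}^{(k)}=1$, and $F_n^{(k)}=F_{n-1}^{(k)}+F_{n-2}^{(k)}+\cdots+F_{n-k}^{(k)}$ for $n\geq k$. -}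

module Defs where

open import Data.Bool using (Bool; true; false; _∨_; not; if_then_else_)
open import Data.Nat using (ℕ; zero; suc; _+_; _*_; _∸_; _/_; _<ᵇ_; _≡ᵇ_)
open import Data.List using (List; []; _∷_; length; filter; map; take; concatMap)
open import Data.Nat.ListAction using (sum)
open import Data.Vec using (Vec; []; _∷_; toList)
open import Data.Integer using (ℤ; +_)
import Data.Integer as ℤ
open import Relation.Nullary using (¬_)
open import Relation.Nullary.Decidable using (does; ¬?)
open import Relation.Binary.PropositionalEquality using (_≡_)
open import Data.Bool.Properties using () renaming (_≟_ to _≟ᵇ_)

-- k-th order Fibonacci numbers F^(k)_n.
-- fibHist k n = [F_n, F_{n-1}, ..., F_0]
fibNext : ℕ → ℕ → List ℕ → ℕ
fibNext k m hist =
  if m <ᵇ (k ∸ 1) then 0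
  else if m ≡ᵇ (k ∸ 1) then 1
  else sum (take k hist)

fibHist : ℕ → ℕ → List ℕ
fibHist k zero    = fibNext k 0 [] ∷ []
fibHist k (suc n) = fibNext k (suc n) (fibHist k n) ∷ fibHist k n

F : ℕ → ℕ → ℕ
F k n with fibHist k n
... | x ∷ _ = x
... | []    = 0

startsWithOnes : ℕ → List Bool → Bool
startsWithOnes zero    _            = true
startsWithOnes (suc k) (true ∷ xs)  = startsWithOnes k xs
startsWithOnes (suc k) _            = false

containsRun : ℕ → List Bool → Bool
containsRun k []       = startsWithOnes k []
containsRun k (x ∷ xs) = startsWithOnes k (x ∷ xs) ∨ containsRun k xs

allStrings : (n : ℕ) → List (Vec Bool n)
allStrings zero    = [] ∷ []
allStrings (suc n) = concatMap (λ v → (false ∷ v) ∷ (true ∷ v) ∷ []) (allStrings n)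

hamming : ∀ {n} → Vec Bool n → Vec Bool n → ℕ
hamming []       []       = 0
hamming (x ∷ xs) (y ∷ ys) = (if does (x ≟ᵇ y) then 0 else 1) + hamming xs ys

fibCubeVertices : ℕ → (n : ℕ) → List (Vec Bool n)
fibCubeVertices k n = filter (λ v → ¬? (containsRun k (toList v) ≟ᵇ true)) (allStrings n)

adjacent? : ∀ {n} (u v : Vec Bool n) → Bool
adjacent? u v = hamming u v ≡ᵇ 1

orderedEdgeCount : ℕ → ℕ → ℕ
orderedEdgeCount k n =
  let V = fibCubeVertices k n in
  length (concatMap (λ u → filter (λ v → adjacent? u v ≟ᵇ true) V) V)

-- e^(k)_n = |E(Γ^(k)_n)| : each undirected edge is counted twice as an ordered pair
e : ℕ → ℕ → ℕ
e k n = orderedEdgeCount k n / 2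

Σℤ : ℕ → (ℕ → ℤ) → ℤ
Σℤ zero    f = + 0
Σℤ (suc m) f = Σℤ m f ℤ.+ f m

A : ℕ → ℕ → ℤ
A k j = (+ ((2 * k) ^ k)) ℤ.- (+ (k * (k + 1) ^ k))
        ℤ.+ (+ ((k ∸ 1) * (k + 1) ^ j * (2 * k) ^ (k ∸ j ∸ 1)))
  where open Data.Nat using (_^_)

B : ℕ → ℕ → ℤ
B k j = (+ ((2 * k) ^ (k ∸ j ∸ 1) * (k + 1) ^ j * (3 * k + (k ∸ 1) * j ∸ 1)))
        ℤ.- (+ (k * (k + 1) ^ k))
  where open Data.Nat using (_^_)

D : ℕ → ℤ
D k = (+ (2 * (2 * k) ^ k)) ℤ.- (+ ((k + 1) ^ (k + 1)))
  where open Data.Nat using (_^_)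

{-# OPTIONS --safe #-}
module Submission where

-- Every edge of Γ⁽ᵏ⁾ₙ joins a vertex to the string obtained by turning one of its 1s into 0, which is
-- again a vertex; hence eₙ is the total number of 1s over all vertices. Sorting strings by their
-- leading run of 1s gives
-- eₙ = Σᵢ₌₁ᵏ (eₙ₋ᵢ + (i − 1) Fₙ₊ₖ₋ᵢ), where eₘ = 0 for m < 0.
--
-- Extend e and F by zero to negative indices and let L z(m) = z(m + k) − Σ_{j<k} z(m + j). Then L F
-- vanishes off m = −1, and L e(m) = Σ_{j<k} (k − 1 − j) F(m + k + j). The operator
-- Δ z(m) = z(m + k + 1) − 2 z(m + k) + z(m) = L z(m + 1) − L z(m) maps
-- Ψ(m) = D eₘ − Σ_{j<k} (m Aⱼ + Bⱼ) Fₘ₊ⱼ to a combination of shifts of L F, whose coefficients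
-- vanish where those shifts are supported: Aⱼ = c + (k − 1) gⱼ with c = (2k)ᵏ − k (k + 1)ᵏ and
-- gⱼ = (k + 1)ʲ (2k)ᵏ⁻¹⁻ʲ geometric of ratio (k + 1)/(2k), and the Bⱼ are what makes the remaining
-- terms cancel. So ΔΨ = 0, and as Ψ vanishes on negative indices, Ψ = 0.

open import Function.Base using (_∘_)
open import Function.Bundles using (Equivalence)
open import Data.Bool.Base using (Bool; true; false; not; _∧_; _∨_; f≤t; b≤b)
import Data.Bool.Base as Bool
open import Data.Bool.Properties using (T-≡) renaming (_≟_ to _≟ᵇ_)
import Data.Bool.Properties as Boolₚ
open import Data.Empty using (⊥-elim)
open import Data.List.Base using (List; []; _∷_; _++_; take; filter; concatMap; length)
open import Data.Nat.Base using (ℕ; zero; suc; _∸_; _<_; _≤_; z≤n; s≤s)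
import Data.Nat.Base as ℕ
import Data.Nat.Properties as ℕₚ
open import Data.Nat.DivMod using (m*n/n≡m)
open import Data.Nat.Induction using (<-rec)
open import Data.Nat.ListAction using (sum)
import Data.Nat.Tactic.RingSolver as ℕ-Solver
open import Data.Integer.Base using (ℤ; 0ℤ; 1ℤ; -1ℤ)
import Data.Integer.Base as ℤ
import Data.Integer.Properties as ℤₚ
open import Data.Integer.Tactic.RingSolver using (solve-∀)
open import Data.Sum.Base using (inj₁; inj₂)
open import Data.Vec.Base using (Vec; []; _∷_; toList)
open import Data.Vec.Relation.Binary.Pointwise.Inductive as Pointwise using (Pointwise; []; _∷_)
open import Relation.Binary.PropositionalEquality
open import Relation.Nullary.Decidable using (does; ¬?; yes; no)
open import Relation.Unary using (Decidable)

open import Defs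

module SumProperties where

  open import Data.Integer.Base using (_+_; _*_; _-_)

  Σℤ-cong : ∀ m {f g : ℕ → ℤ} → (∀ {j} → j < m → f j ≡ g j) → Σℤ m f ≡ Σℤ m g
  Σℤ-cong zero    f≡g = refl
  Σℤ-cong (suc m) f≡g = cong₂ _+_ (Σℤ-cong m (f≡g ∘ ℕₚ.m<n⇒m<1+n)) (f≡g (ℕₚ.n<1+n m))

  Σℤ-zero : ∀ m {f : ℕ → ℤ} → (∀ {j} → j < m → f j ≡ 0ℤ) → Σℤ m f ≡ 0ℤ
  Σℤ-zero zero    f≡0 = refl
  Σℤ-zero (suc m) f≡0 = cong₂ _+_ (Σℤ-zero m (f≡0 ∘ ℕₚ.m<n⇒m<1+n)) (f≡0 (ℕₚ.n<1+n m))

  Σℤ-head : ∀ m (f : ℕ → ℤ) → Σℤ (suc m) f ≡ f 0 + Σℤ m (f ∘ suc)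
  Σℤ-head zero    f = trans (ℤₚ.+-identityˡ (f 0)) (sym (ℤₚ.+-identityʳ (f 0)))
  Σℤ-head (suc m) f = trans (cong (_+ f (suc m)) (Σℤ-head m f)) (ℤₚ.+-assoc (f 0) _ _)

  Σℤ-distrib-+ : ∀ m (f g : ℕ → ℤ) → Σℤ m (λ j → f j + g j) ≡ Σℤ m f + Σℤ m g
  Σℤ-distrib-+ zero    f g = refl
  Σℤ-distrib-+ (suc m) f g =
    trans (cong (_+ (f m + g m)) (Σℤ-distrib-+ m f g)) (interchange (Σℤ m f) (Σℤ m g) (f m) (g m))
    where
    interchange : ∀ x y z w → x + y + (z + w) ≡ x + z + (y + w)
    interchange = solve-∀

  Σℤ-distrib-minus : ∀ m (f g : ℕ → ℤ) → Σℤ m (λ j → f j - g j) ≡ Σℤ m f - Σℤ m g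
  Σℤ-distrib-minus zero    f g = refl
  Σℤ-distrib-minus (suc m) f g =
    trans (cong (_+ (f m - g m)) (Σℤ-distrib-minus m f g)) (interchange (Σℤ m f) (Σℤ m g) (f m) (g m))
    where
    interchange : ∀ x y z w → x - y + (z - w) ≡ x + z - (y + w)
    interchange = solve-∀

  *-distribˡ-Σℤ : ∀ c m (f : ℕ → ℤ) → c * Σℤ m f ≡ Σℤ m (λ j → c * f j)
  *-distribˡ-Σℤ c zero    f = ℤₚ.*-zeroʳ c
  *-distribˡ-Σℤ c (suc m) f =
    trans (ℤₚ.*-distribˡ-+ c (Σℤ m f) (f m)) (cong (_+ c * f m) (*-distribˡ-Σℤ c m f))

  Σℤ-comm : ∀ m n (f : ℕ → ℕ → ℤ) →
            Σℤ m (λ i → Σℤ n (f i)) ≡ Σℤ n (λ j → Σℤ m (λ i → f i j))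
  Σℤ-comm zero    n f = sym (Σℤ-zero n (λ _ → refl))
  Σℤ-comm (suc m) n f = trans (cong (_+ Σℤ n (f m)) (Σℤ-comm m n f)) (sym (Σℤ-distrib-+ n _ (f m)))

module FibonacciProperties where

  open import Data.Nat.Base using (_+_; _<ᵇ_; _≡ᵇ_)
  open import Data.Integer.Base using (+_)

  private
    <ᵇ-true : ∀ {m n} → m < n → (m <ᵇ n) ≡ true
    <ᵇ-true m<n = Equivalence.to T-≡ (ℕₚ.<⇒<ᵇ m<n)

    <ᵇ-false : ∀ {m n} → n ≤ m → (m <ᵇ n) ≡ false
    <ᵇ-false {m} {n} n≤m with m <ᵇ n | ℕₚ.<ᵇ⇒< m n
    ... | false | _   = refl
    ... | true  | m<n = ⊥-elim (ℕₚ.≤⇒≯ n≤m (m<n _))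

    ≡ᵇ-refl : ∀ m → (m ≡ᵇ m) ≡ true
    ≡ᵇ-refl m = Equivalence.to T-≡ (ℕₚ.≡⇒≡ᵇ m m refl)

    ≡ᵇ-false : ∀ {m n} → m ≢ n → (m ≡ᵇ n) ≡ false
    ≡ᵇ-false {m} {n} m≢n with m ≡ᵇ n | ℕₚ.≡ᵇ⇒≡ m n
    ... | false | _   = refl
    ... | true  | m≡n = ⊥-elim (m≢n (m≡n _))

    history : ℕ → ℕ → List ℕ
    history k zero    = []
    history k (suc m) = fibHist k m

    F-unfold : ∀ k m → F k m ≡ fibNext k m (history k m)
    F-unfold k zero    = refl
    F-unfold k (suc m) = refl

  F-below : ∀ k {q} → q < k ∸ 1 → F k q ≡ 0
  F-below k {q} q<k-1 rewrite F-unfold k q | <ᵇ-true q<k-1 = refl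

  F-seed : ∀ k → F k (k ∸ 1) ≡ 1
  F-seed k rewrite F-unfold k (k ∸ 1) | <ᵇ-false (ℕₚ.≤-refl {k ∸ 1}) | ≡ᵇ-refl (k ∸ 1) = refl

  sum-take-fibHist : ∀ k q s r → s + r ≡ suc q →
                     + sum (take s (fibHist k q)) ≡ Σℤ s (λ j → + F k (r + j))
  sum-take-fibHist k q       zero          r       _  = refl
  sum-take-fibHist k zero    (suc zero)    zero    _  = cong +_ (ℕₚ.+-identityʳ (F k 0))
  sum-take-fibHist k zero    (suc zero)    (suc r) ()
  sum-take-fibHist k zero    (suc (suc s)) r       ()
  sum-take-fibHist k (suc q) (suc s)       r       1+s+r≡2+q = begin
    + (F k (suc q) + sum (take s (fibHist k q)))
      ≡⟨ ℤₚ.+-comm (+ F k (suc q)) (+ sum (take s (fibHist k q))) ⟩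
    + sum (take s (fibHist k q)) ℤ.+ + F k (suc q)
      ≡⟨ cong₂ ℤ._+_ (sum-take-fibHist k q s r s+r≡1+q)
                     (cong (+_ ∘ F k) (trans (sym s+r≡1+q) (ℕₚ.+-comm s r))) ⟩
    Σℤ s (λ j → + F k (r + j)) ℤ.+ + F k (r + s) ∎
    where
    open ≡-Reasoning
    s+r≡1+q : s + r ≡ suc q
    s+r≡1+q = ℕₚ.suc-injective 1+s+r≡2+q

  F-recurrence : ∀ k' n → + F (suc k') (n + suc k') ≡ Σℤ (suc k') (λ j → + F (suc k') (n + j))
  F-recurrence k' n
    rewrite ℕₚ.+-suc n k'
          | <ᵇ-false (ℕₚ.m≤n⇒m≤1+n (ℕₚ.m≤n+m k' n))
          | ≡ᵇ-false {suc (n + k')} {k'} (ℕₚ.>⇒≢ (s≤s (ℕₚ.m≤n+m k' n)))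
    = sum-take-fibHist (suc k') (n + k') (suc k') n (cong suc (ℕₚ.+-comm k' n))

module EdgeCounting where

  open import Data.Nat.Base using (_+_; _*_; _/_; _≡ᵇ_)

  toℕ : Bool → ℕ
  toℕ false = 0
  toℕ true  = 1

  sumOver : {A : Set} → List A → (A → ℕ) → ℕ
  sumOver []       f = 0
  sumOver (x ∷ xs) f = f x + sumOver xs f

  infix 5 sumOver
  syntax sumOver xs (λ x → e) = ∑[ x ∈ xs ] e

  module _ {A : Set} where

    ∑-cong : ∀ xs {f g : A → ℕ} → (∀ x → f x ≡ g x) → sumOver xs f ≡ sumOver xs g
    ∑-cong []       f≡g = refl
    ∑-cong (x ∷ xs) f≡g = cong₂ _+_ (f≡g x) (∑-cong xs f≡g)

    ∑-zero : ∀ xs {f : A → ℕ} → (∀ x → f x ≡ 0) → sumOver xs f ≡ 0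
    ∑-zero []       f≡0 = refl
    ∑-zero (x ∷ xs) f≡0 = cong₂ _+_ (f≡0 x) (∑-zero xs f≡0)

    ∑-distrib-+ : ∀ xs (f g : A → ℕ) → ∑[ x ∈ xs ] (f x + g x) ≡ sumOver xs f + sumOver xs g
    ∑-distrib-+ []       f g = refl
    ∑-distrib-+ (x ∷ xs) f g =
      trans (cong (f x + g x +_) (∑-distrib-+ xs f g))
            (interchange (f x) (g x) (sumOver xs f) (sumOver xs g))
      where
      interchange : ∀ a b c d → a + b + (c + d) ≡ a + c + (b + d)
      interchange = ℕ-Solver.solve-∀

    *-distribˡ-∑ : ∀ c xs (f : A → ℕ) → c * sumOver xs f ≡ ∑[ x ∈ xs ] c * f x
    *-distribˡ-∑ c []       f = ℕₚ.*-zeroʳ c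
    *-distribˡ-∑ c (x ∷ xs) f =
      trans (ℕₚ.*-distribˡ-+ c (f x) (sumOver xs f)) (cong (c * f x +_) (*-distribˡ-∑ c xs f))

    ∑-++ : ∀ xs ys (f : A → ℕ) → sumOver (xs ++ ys) f ≡ sumOver xs f + sumOver ys f
    ∑-++ []       ys f = refl
    ∑-++ (x ∷ xs) ys f =
      trans (cong (f x +_) (∑-++ xs ys f)) (sym (ℕₚ.+-assoc (f x) (sumOver xs f) (sumOver ys f)))

    ∑-concatMap : ∀ {B : Set} (g : B → List A) xs (f : A → ℕ) →
                  sumOver (concatMap g xs) f ≡ ∑[ x ∈ xs ] sumOver (g x) f
    ∑-concatMap g []       f = refl
    ∑-concatMap g (x ∷ xs) f =
      trans (∑-++ (g x) (concatMap g xs) f) (cong (sumOver (g x) f +_) (∑-concatMap g xs f))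

    length-as-∑ : ∀ (xs : List A) → length xs ≡ ∑[ x ∈ xs ] 1
    length-as-∑ []       = refl
    length-as-∑ (x ∷ xs) = cong suc (length-as-∑ xs)

    ∑-filter : ∀ {P : A → Set} (P? : Decidable P) (p : A → Bool) → (∀ x → does (P? x) ≡ p x) →
               ∀ xs (f : A → ℕ) → sumOver (filter P? xs) f ≡ ∑[ x ∈ xs ] toℕ (p x) * f x
    ∑-filter P? p P?≡p []       f = refl
    ∑-filter P? p P?≡p (x ∷ xs) f with does (P? x) | p x | P?≡p x
    ... | true  | _ | refl = cong₂ _+_ (sym (ℕₚ.+-identityʳ (f x))) (∑-filter P? p P?≡p xs f)
    ... | false | _ | refl = ∑-filter P? p P?≡p xs f

  does-≟-true : ∀ b → does (b ≟ᵇ true) ≡ b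
  does-≟-true false = refl
  does-≟-true true  = refl

  weight : ∀ {n} → Vec Bool n → ℕ
  weight []      = 0
  weight (b ∷ w) = toℕ b + weight w

  ∑-allStrings-suc : ∀ n (f : Vec Bool (suc n) → ℕ) →
    ∑[ w ∈ allStrings (suc n) ] f w ≡ ∑[ w ∈ allStrings n ] (f (false ∷ w) + f (true ∷ w))
  ∑-allStrings-suc n f =
    trans (∑-concatMap _ (allStrings n) f)
          (∑-cong (allStrings n) (λ w → cong (f (false ∷ w) +_) (ℕₚ.+-identityʳ (f (true ∷ w)))))

  ∑-diagonal : ∀ {n} (u : Vec Bool n) (f : Vec Bool n → ℕ) →
    ∑[ v ∈ allStrings n ] f v * toℕ (hamming u v ≡ᵇ 0) ≡ f u
  ∑-diagonal []                  f = trans (ℕₚ.+-identityʳ _) (ℕₚ.*-identityʳ (f []))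
  ∑-diagonal {suc n} (false ∷ u) f =
    trans (∑-allStrings-suc n _)
          (trans (∑-cong (allStrings n) (λ w → trans (cong (f (false ∷ w) * toℕ (hamming u w ≡ᵇ 0) +_)
                                                           (ℕₚ.*-zeroʳ (f (true ∷ w))))
                                                     (ℕₚ.+-identityʳ _)))
                 (∑-diagonal u (f ∘ (false ∷_))))
  ∑-diagonal {suc n} (true ∷ u)  f =
    trans (∑-allStrings-suc n _)
          (trans (∑-cong (allStrings n) (λ w → cong (_+ f (true ∷ w) * toℕ (hamming u w ≡ᵇ 0))
                                                    (ℕₚ.*-zeroʳ (f (false ∷ w)))))
                 (∑-diagonal u (f ∘ (true ∷_))))

  neighbours : ∀ {n} → (Vec Bool n → Bool) → Vec Bool n → ℕ
  neighbours {n} Q u = ∑[ v ∈ allStrings n ] toℕ (Q v) * toℕ (adjacent? u v)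

  neighbours-cons : ∀ {n} (Q : Vec Bool (suc n) → Bool) b u →
    neighbours Q (b ∷ u) ≡ neighbours (Q ∘ (b ∷_)) u + toℕ (Q (not b ∷ u))
  neighbours-cons {n} Q false u =
    trans (∑-allStrings-suc n _)
          (trans (∑-distrib-+ (allStrings n) _ _)
                 (cong (neighbours (Q ∘ (false ∷_)) u +_) (∑-diagonal u (toℕ ∘ Q ∘ (true ∷_)))))
  neighbours-cons {n} Q true u =
    trans (∑-allStrings-suc n _)
          (trans (∑-distrib-+ (allStrings n) _ _)
                 (trans (cong (_+ neighbours (Q ∘ (true ∷_)) u) (∑-diagonal u (toℕ ∘ Q ∘ (false ∷_))))
                        (ℕₚ.+-comm (toℕ (Q (false ∷ u))) (neighbours (Q ∘ (true ∷_)) u))))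

  count weightSum adjacentPairs : ∀ {n} → (Vec Bool n → Bool) → ℕ
  count         {n} P = ∑[ w ∈ allStrings n ] toℕ (P w)
  weightSum     {n} P = ∑[ w ∈ allStrings n ] toℕ (P w) * weight w
  adjacentPairs {n} P = ∑[ w ∈ allStrings n ] toℕ (P w) * neighbours P w

  count-cong : ∀ {n} {P Q : Vec Bool n → Bool} → (∀ w → P w ≡ Q w) → count P ≡ count Q
  count-cong P≡Q = ∑-cong (allStrings _) (cong toℕ ∘ P≡Q)

  weightSum-cong : ∀ {n} {P Q : Vec Bool n → Bool} → (∀ w → P w ≡ Q w) → weightSum P ≡ weightSum Q
  weightSum-cong P≡Q = ∑-cong (allStrings _) (λ w → cong (λ b → toℕ b * weight w) (P≡Q w))

  count-cons : ∀ {n} (P : Vec Bool (suc n) → Bool) →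
    count P ≡ count (P ∘ (false ∷_)) + count (P ∘ (true ∷_))
  count-cons {n} P = trans (∑-allStrings-suc n _) (∑-distrib-+ (allStrings n) _ _)

  weightSum-cons : ∀ {n} (P : Vec Bool (suc n) → Bool) →
    weightSum P ≡ weightSum (P ∘ (false ∷_)) + weightSum (P ∘ (true ∷_)) + count (P ∘ (true ∷_))
  weightSum-cons {n} P = begin
    weightSum P
      ≡⟨ ∑-allStrings-suc n _ ⟩
    ∑[ w ∈ allStrings n ] (toℕ (P₀ w) * weight w + toℕ (P₁ w) * suc (weight w))
      ≡⟨ ∑-cong (allStrings n) (λ w → split (toℕ (P₀ w)) (toℕ (P₁ w)) (weight w)) ⟩
    ∑[ w ∈ allStrings n ] (toℕ (P₀ w) * weight w + toℕ (P₁ w) * weight w + toℕ (P₁ w))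
      ≡⟨ trans (∑-distrib-+ (allStrings n) _ _) (cong (_+ count P₁) (∑-distrib-+ (allStrings n) _ _)) ⟩
    weightSum P₀ + weightSum P₁ + count P₁ ∎
    where
    open ≡-Reasoning
    P₀ P₁ : Vec Bool n → Bool
    P₀ = P ∘ (false ∷_)
    P₁ = P ∘ (true ∷_)
    split : ∀ a b x → a * x + b * suc x ≡ a * x + b * x + b
    split = ℕ-Solver.solve-∀

  DownClosed : ∀ {n} → (Vec Bool n → Bool) → Set
  DownClosed P = ∀ {u v} → Pointwise Bool._≤_ u v → P v Bool.≤ P u

  toℕ-*-≤ : ∀ {a b} → a Bool.≤ b → toℕ b * toℕ a ≡ toℕ a
  toℕ-*-≤ f≤t         = refl
  toℕ-*-≤ {false} b≤b = refl
  toℕ-*-≤ {true}  b≤b = refl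

  adjacentPairs-cons : ∀ {n} (P : Vec Bool (suc n) → Bool) → DownClosed P →
    adjacentPairs P
      ≡ adjacentPairs (P ∘ (false ∷_)) + adjacentPairs (P ∘ (true ∷_)) + 2 * count (P ∘ (true ∷_))
  adjacentPairs-cons {n} P down = begin
    adjacentPairs P
      ≡⟨ ∑-allStrings-suc n _ ⟩
    ∑[ w ∈ allStrings n ] (toℕ (P₀ w) * neighbours P (false ∷ w) + toℕ (P₁ w) * neighbours P (true ∷ w))
      ≡⟨ ∑-cong (allStrings n) (λ w → cong₂ (λ x y → toℕ (P₀ w) * x + toℕ (P₁ w) * y)
                                            (neighbours-cons P false w) (neighbours-cons P true w)) ⟩
    ∑[ w ∈ allStrings n ] (toℕ (P₀ w) * (neighbours P₀ w + toℕ (P₁ w))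
                           + toℕ (P₁ w) * (neighbours P₁ w + toℕ (P₀ w)))
      ≡⟨ ∑-cong (allStrings n) (λ w → split (toℕ (P₀ w)) (toℕ (P₁ w)) (neighbours P₀ w) (neighbours P₁ w)
                                            (toℕ-*-≤ (down (f≤t ∷ Pointwise.refl Boolₚ.≤-refl)))) ⟩
    ∑[ w ∈ allStrings n ] (toℕ (P₀ w) * neighbours P₀ w + toℕ (P₁ w) * neighbours P₁ w + 2 * toℕ (P₁ w))
      ≡⟨ trans (∑-distrib-+ (allStrings n) _ _)
               (cong₂ _+_ (∑-distrib-+ (allStrings n) _ _) (sym (*-distribˡ-∑ 2 (allStrings n) (toℕ ∘ P₁)))) ⟩
    adjacentPairs P₀ + adjacentPairs P₁ + 2 * count P₁ ∎
    where
    open ≡-Reasoning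
    P₀ P₁ : Vec Bool n → Bool
    P₀ = P ∘ (false ∷_)
    P₁ = P ∘ (true ∷_)
    expand : ∀ a b x y → a * (x + b) + b * (y + a) ≡ a * x + b * y + 2 * (a * b)
    expand = ℕ-Solver.solve-∀
    split : ∀ a b x y → a * b ≡ b → a * (x + b) + b * (y + a) ≡ a * x + b * y + 2 * b
    split a b x y ab≡b = trans (expand a b x y) (cong (λ t → a * x + b * y + 2 * t) ab≡b)

  adjacentPairs-downClosed : ∀ {n} (P : Vec Bool n → Bool) → DownClosed P → adjacentPairs P ≡ 2 * weightSum P
  adjacentPairs-downClosed {zero}  P down rewrite ℕₚ.*-zeroʳ (toℕ (P [])) | ℕₚ.*-zeroʳ (toℕ (P [])) = refl
  adjacentPairs-downClosed {suc n} P down = begin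
    adjacentPairs P
      ≡⟨ adjacentPairs-cons P down ⟩
    adjacentPairs P₀ + adjacentPairs P₁ + 2 * count P₁
      ≡⟨ cong₂ (λ x y → x + y + 2 * count P₁) (adjacentPairs-downClosed P₀ (down ∘ (b≤b ∷_)))
                                              (adjacentPairs-downClosed P₁ (down ∘ (b≤b ∷_))) ⟩
    2 * weightSum P₀ + 2 * weightSum P₁ + 2 * count P₁
      ≡⟨ factor (weightSum P₀) (weightSum P₁) (count P₁) ⟩
    2 * (weightSum P₀ + weightSum P₁ + count P₁)
      ≡⟨ cong (2 *_) (weightSum-cons P) ⟨
    2 * weightSum P ∎
    where
    open ≡-Reasoning
    P₀ P₁ : Vec Bool n → Bool
    P₀ = P ∘ (false ∷_)
    P₁ = P ∘ (true ∷_)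
    factor : ∀ a b c → 2 * a + 2 * b + 2 * c ≡ 2 * (a + b + c)
    factor = ℕ-Solver.solve-∀

  valid : ℕ → ∀ {n} → Vec Bool n → Bool
  valid k w = not (containsRun k (toList w))

  ∨-mono-≤ : ∀ {a b c d} → a Bool.≤ b → c Bool.≤ d → a ∨ c Bool.≤ b ∨ d
  ∨-mono-≤ f≤t         _   = Boolₚ.≤-maximum _
  ∨-mono-≤ {true}  b≤b _   = b≤b
  ∨-mono-≤ {false} b≤b c≤d = c≤d

  not-antitone : ∀ {a b} → a Bool.≤ b → not b Bool.≤ not a
  not-antitone f≤t = f≤t
  not-antitone b≤b = b≤b

  startsWithOnes-mono : ∀ k {n} {u v : Vec Bool n} → Pointwise Bool._≤_ u v →
                        startsWithOnes k (toList u) Bool.≤ startsWithOnes k (toList v)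
  startsWithOnes-mono zero    _                 = b≤b
  startsWithOnes-mono (suc k) []                = b≤b
  startsWithOnes-mono (suc k) (f≤t ∷ _)         = Boolₚ.≤-minimum _
  startsWithOnes-mono (suc k) (b≤b {false} ∷ _) = b≤b
  startsWithOnes-mono (suc k) (b≤b {true} ∷ u≤v) = startsWithOnes-mono k u≤v

  containsRun-mono : ∀ k {n} {u v : Vec Bool n} → Pointwise Bool._≤_ u v →
                     containsRun k (toList u) Bool.≤ containsRun k (toList v)
  containsRun-mono k []         = b≤b
  containsRun-mono k (x≤y ∷ u≤v) = ∨-mono-≤ (startsWithOnes-mono k (x≤y ∷ u≤v)) (containsRun-mono k u≤v)

  valid-downClosed : ∀ k {n} → DownClosed (valid k {n})
  valid-downClosed k = not-antitone ∘ containsRun-mono k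

  orderedEdgeCount≡adjacentPairs : ∀ k n → orderedEdgeCount k n ≡ adjacentPairs (valid k {n})
  orderedEdgeCount≡adjacentPairs k n = begin
    length (concatMap adjacentIn V)
      ≡⟨ length-as-∑ (concatMap adjacentIn V) ⟩
    ∑[ v ∈ concatMap adjacentIn V ] 1
      ≡⟨ ∑-concatMap adjacentIn V (λ _ → 1) ⟩
    ∑[ u ∈ V ] (∑[ v ∈ adjacentIn u ] 1)
      ≡⟨ ∑-cong V (λ u → ∑-filter _ (adjacent? u) (does-≟-true ∘ adjacent? u) V (λ _ → 1)) ⟩
    ∑[ u ∈ V ] (∑[ v ∈ V ] toℕ (adjacent? u v) * 1)
      ≡⟨ ∑-filter _ (valid k) isValid (allStrings n) _ ⟩
    ∑[ u ∈ allStrings n ] toℕ (valid k u) * (∑[ v ∈ V ] toℕ (adjacent? u v) * 1)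
      ≡⟨ ∑-cong (allStrings n) (λ u → cong (toℕ (valid k u) *_)
           (trans (∑-filter _ (valid k) isValid (allStrings n) _)
                  (∑-cong (allStrings n) (λ v → cong (toℕ (valid k v) *_) (ℕₚ.*-identityʳ _))))) ⟩
    adjacentPairs (valid k {n}) ∎
    where
    open ≡-Reasoning
    V : List (Vec Bool n)
    V = fibCubeVertices k n
    adjacentIn : Vec Bool n → List (Vec Bool n)
    adjacentIn u = filter (λ v → adjacent? u v ≟ᵇ true) V
    isValid : ∀ v → does (¬? (containsRun k (toList v) ≟ᵇ true)) ≡ valid k v
    isValid v = cong not (does-≟-true (containsRun k (toList v)))

  e≡weightSum : ∀ k n → e k n ≡ weightSum (valid k {n})
  e≡weightSum k n = begin
    orderedEdgeCount k n / 2
      ≡⟨ cong (_/ 2) (trans (orderedEdgeCount≡adjacentPairs k n)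
                            (adjacentPairs-downClosed (valid k {n}) (valid-downClosed k))) ⟩
    2 * weightSum (valid k {n}) / 2
      ≡⟨ cong (_/ 2) (ℕₚ.*-comm 2 (weightSum (valid k {n}))) ⟩
    weightSum (valid k {n}) * 2 / 2
      ≡⟨ m*n/n≡m (weightSum (valid k {n})) 2 ⟩
    weightSum (valid k {n}) ∎
    where open ≡-Reasoning

module LeadingRuns where

  open import Data.Nat.Base using (_+_)
  open EdgeCounting

  -- The valid strings with fewer than s leading 1s, i.e. the w for which 1ᵏ⁻ˢw is still valid.
  validLead : ℕ → ℕ → ∀ {n} → Vec Bool n → Bool
  validLead k s w = valid k w ∧ not (startsWithOnes s (toList w))

  startsWithOnes-antitone : ∀ {s t} → s ≤ t → ∀ xs → startsWithOnes t xs Bool.≤ startsWithOnes s xs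
  startsWithOnes-antitone {zero}  _         xs           = Boolₚ.≤-maximum _
  startsWithOnes-antitone {suc s} (s≤s s≤t) []           = b≤b
  startsWithOnes-antitone {suc s} (s≤s s≤t) (false ∷ xs) = b≤b
  startsWithOnes-antitone {suc s} (s≤s s≤t) (true ∷ xs)  = startsWithOnes-antitone s≤t xs

  startsWithOnes⇒containsRun : ∀ k xs → startsWithOnes k xs ≡ true → containsRun k xs ≡ true
  startsWithOnes⇒containsRun k []       k-ones = k-ones
  startsWithOnes⇒containsRun k (x ∷ xs) k-ones = cong (_∨ containsRun k xs) k-ones

  validLead-zero : ∀ k {n} (w : Vec Bool n) → validLead k 0 w ≡ false
  validLead-zero k w = Boolₚ.∧-zeroʳ (valid k w)

  validLead-full : ∀ k {n} (w : Vec Bool n) → validLead k k w ≡ valid k w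
  validLead-full k w with startsWithOnes k (toList w) in k-ones
  ... | true  rewrite startsWithOnes⇒containsRun k (toList w) k-ones = refl
  ... | false = Boolₚ.∧-identityʳ (valid k w)

  validLead-false∷ : ∀ k' s {n} (w : Vec Bool n) →
    validLead (suc k') (suc s) (false ∷ w) ≡ validLead (suc k') (suc k') w
  validLead-false∷ k' s w = trans (Boolₚ.∧-identityʳ _) (sym (validLead-full (suc k') w))

  validLead-true∷ : ∀ {k' s} → s ≤ k' → ∀ {n} (w : Vec Bool n) →
    validLead (suc k') (suc s) (true ∷ w) ≡ validLead (suc k') s w
  validLead-true∷ {k'} {s} s≤k' w
    with startsWithOnes s (toList w) | startsWithOnes k' (toList w) | startsWithOnes-antitone s≤k' (toList w)
  ... | true  | _     | _ = trans (Boolₚ.∧-zeroʳ _) (sym (Boolₚ.∧-zeroʳ _))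
  ... | false | false | _ = refl

  count-validLead-suc : ∀ {k' s} → s ≤ k' → ∀ n →
    count (validLead (suc k') (suc s) {suc n})
      ≡ count (validLead (suc k') (suc k') {n}) + count (validLead (suc k') s {n})
  count-validLead-suc {k'} {s} s≤k' n =
    trans (count-cons (validLead (suc k') (suc s) {suc n}))
          (cong₂ _+_ (count-cong (validLead-false∷ k' s {n})) (count-cong (validLead-true∷ s≤k' {n})))

  weightSum-validLead-suc : ∀ {k' s} → s ≤ k' → ∀ n →
    weightSum (validLead (suc k') (suc s) {suc n})
      ≡ weightSum (validLead (suc k') (suc k') {n}) + weightSum (validLead (suc k') s {n})
        + count (validLead (suc k') s {n})
  weightSum-validLead-suc {k'} {s} s≤k' n =
    trans (weightSum-cons (validLead (suc k') (suc s) {suc n}))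
          (cong₂ _+_ (cong₂ _+_ (weightSum-cong (validLead-false∷ k' s {n}))
                                (weightSum-cong (validLead-true∷ s≤k' {n})))
                     (count-cong (validLead-true∷ s≤k' {n})))

module ZeroExtension where

  open import Data.Integer.Base using (+_; -[1+_])

  extend : (ℕ → ℕ) → ℤ → ℤ
  extend f (+ n)    = + f n
  extend f -[1+ _ ] = 0ℤ

  extend-negative : ∀ f {m} → m ℤ.< 0ℤ → extend f m ≡ 0ℤ
  extend-negative f { -[1+ _ ]} _          = refl
  extend-negative f {+ _}      (ℤ.+<+ ())

  extend-⊖ : ∀ f {j a} → j < a → extend f (j ℤ.⊖ a) ≡ 0ℤ
  extend-⊖ f {j} {a} j<a rewrite ℤₚ.⊖-< j<a | ℕₚ.+-∸-assoc 1 j<a = refl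

module Recurrence (k' : ℕ) where

  open import Data.Integer.Base using (+_; _+_; _*_; _-_)
  open SumProperties
  open FibonacciProperties using (F-below; F-seed; F-recurrence)
  open EdgeCounting
  open LeadingRuns
  open ZeroExtension

  private
    k : ℕ
    k = suc k'

    pred-sum : ∀ {r s} → r ℕ.+ suc s ≡ k → r ℕ.+ s ≡ k'
    pred-sum {r} {s} r+1+s≡k = ℕₚ.suc-injective (trans (sym (ℕₚ.+-suc r s)) r+1+s≡k)

    s≤k' : ∀ {r s} → r ℕ.+ suc s ≡ k → s ≤ k'
    s≤k' {r} {s} r+1+s≡k = subst (s ≤_) (pred-sum r+1+s≡k) (ℕₚ.m≤n+m s r)

    shift-sum : ∀ {r s} → r ℕ.+ suc s ≡ k → suc r ℕ.+ s ≡ k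
    shift-sum {r} {s} = trans (sym (ℕₚ.+-suc r s))

  ê : ℤ → ℤ
  ê = extend (e k)

  -- The offset r = k - s is carried as the hypothesis r + s ≡ k to avoid truncated subtraction.
  count-validLead : ∀ n r s → r ℕ.+ s ≡ k →
    + count (validLead k s {n}) ≡ Σℤ s (λ j → + F k (n ℕ.+ (r ℕ.+ j)))
  count-validLead n       r zero    _ =
    cong +_ (trans (count-cong (validLead-zero k {n})) (∑-zero (allStrings n) (λ _ → refl)))
  count-validLead zero    r (suc s) r+1+s≡k = sym (cong₂ _+_
    (Σℤ-zero s (λ j<s → cong +_ (F-below k (subst (r ℕ.+ _ <_) (pred-sum r+1+s≡k) (ℕₚ.+-monoʳ-< r j<s)))))
    (cong +_ (trans (cong (F k) (pred-sum r+1+s≡k)) (F-seed k))))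
  count-validLead (suc n) r (suc s) r+1+s≡k = begin
    + count (validLead k (suc s) {suc n})
      ≡⟨ cong +_ (count-validLead-suc (s≤k' r+1+s≡k) n) ⟩
    + count (validLead k k {n}) + + count (validLead k s {n})
      ≡⟨ cong₂ _+_ (count-validLead n 0 k refl) (count-validLead n (suc r) s (shift-sum r+1+s≡k)) ⟩
    Σℤ k (λ j → + F k (n ℕ.+ j)) + Σℤ s (λ j → + F k (n ℕ.+ (suc r ℕ.+ j)))
      ≡⟨ cong₂ _+_ (sym (F-recurrence k' n))
                   (Σℤ-cong s (λ {j} _ → cong (+_ ∘ F k) (ℕₚ.+-suc n (r ℕ.+ j)))) ⟩
    + F k (n ℕ.+ k) + Σℤ s (λ j → + F k (suc n ℕ.+ (r ℕ.+ j)))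
      ≡⟨ ℤₚ.+-comm (+ F k (n ℕ.+ k)) (Σℤ s (λ j → + F k (suc n ℕ.+ (r ℕ.+ j)))) ⟩
    Σℤ s (λ j → + F k (suc n ℕ.+ (r ℕ.+ j))) + + F k (n ℕ.+ k)
      ≡⟨ cong (λ i → Σℤ s (λ j → + F k (suc n ℕ.+ (r ℕ.+ j))) + + F k i) last-index ⟩
    Σℤ (suc s) (λ j → + F k (suc n ℕ.+ (r ℕ.+ j))) ∎
    where
    open ≡-Reasoning
    last-index : n ℕ.+ k ≡ suc n ℕ.+ (r ℕ.+ s)
    last-index = trans (ℕₚ.+-suc n k') (cong (suc ∘ (n ℕ.+_)) (sym (pred-sum r+1+s≡k)))

  e≡weightSum-validLead : ∀ n → e k n ≡ weightSum (validLead k k {n})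
  e≡weightSum-validLead n = trans (e≡weightSum k n) (weightSum-cong (sym ∘ validLead-full k {n}))

  weightSum-validLead : ∀ n r s → r ℕ.+ s ≡ k →
    + weightSum (validLead k s {n})
      ≡ Σℤ s (λ j → ê (+ n - + s + + j) + + (s ∸ suc j) * + F k (n ℕ.+ (r ℕ.+ j)))
  weightSum-validLead n       r zero    _ =
    cong +_ (trans (weightSum-cong (validLead-zero k {n})) (∑-zero (allStrings n) (λ _ → refl)))
  weightSum-validLead zero    r (suc s) r+1+s≡k =
    sym (Σℤ-zero (suc s) (λ j<1+s → cong₂ _+_ (extend-⊖ (e k) j<1+s) (vanish j<1+s)))
    where
    vanish : ∀ {j} → j < suc s → + (s ∸ j) * + F k (r ℕ.+ j) ≡ 0ℤ
    vanish {j} j<1+s with ℕₚ.m<1+n⇒m<n∨m≡n j<1+s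
    ... | inj₁ j<s  = trans (cong (λ x → + (s ∸ j) * + x)
                                  (F-below k (subst (r ℕ.+ j <_) (pred-sum r+1+s≡k) (ℕₚ.+-monoʳ-< r j<s))))
                            (ℤₚ.*-zeroʳ (+ (s ∸ j)))
    ... | inj₂ refl rewrite ℕₚ.n∸n≡0 j = ℤₚ.*-zeroˡ (+ F k (r ℕ.+ j))
  weightSum-validLead (suc n) r (suc s) r+1+s≡k = begin
    + weightSum (validLead k (suc s) {suc n})
      ≡⟨ cong +_ (weightSum-validLead-suc (s≤k' r+1+s≡k) n) ⟩
    + weightSum (validLead k k {n}) + + weightSum (validLead k s {n}) + + count (validLead k s {n})
      ≡⟨ cong₂ _+_ (cong₂ _+_ (cong +_ (sym (e≡weightSum-validLead n)))
                              (weightSum-validLead n (suc r) s (shift-sum r+1+s≡k)))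
                   (count-validLead n (suc r) s (shift-sum r+1+s≡k)) ⟩
    + e k n + Σℤ s term + Σℤ s fib
      ≡⟨ trans (rotate (+ e k n) (Σℤ s term) (Σℤ s fib)) (cong (_+ + e k n) (sym (Σℤ-distrib-+ s term fib))) ⟩
    Σℤ s (λ j → term j + fib j) + + e k n
      ≡⟨ cong₂ _+_ (Σℤ-cong s step) (sym last) ⟩
    Σℤ (suc s) (λ j → ê (+ suc n - + suc s + + j) + + (suc s ∸ suc j) * + F k (suc n ℕ.+ (r ℕ.+ j))) ∎
    where
    open ≡-Reasoning
    term fib : ℕ → ℤ
    term j = ê (+ n - + s + + j) + + (s ∸ suc j) * + F k (n ℕ.+ (suc r ℕ.+ j))
    fib  j = + F k (n ℕ.+ (suc r ℕ.+ j))
    rotate : ∀ a b c → a + b + c ≡ b + c + a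
    rotate = solve-∀
    shift : ∀ n s j → + 1 + n - (+ 1 + s) + j ≡ n - s + j
    shift = solve-∀
    absorb : ∀ a x f → a + x * f + f ≡ a + (+ 1 + x) * f
    absorb = solve-∀
    step : ∀ {j} → j < s →
           term j + fib j ≡ ê (+ suc n - + suc s + + j) + + (s ∸ j) * + F k (suc n ℕ.+ (r ℕ.+ j))
    step {j} j<s = begin
      term j + fib j
        ≡⟨ absorb (ê (+ n - + s + + j)) (+ (s ∸ suc j)) (fib j) ⟩
      ê (+ n - + s + + j) + + suc (s ∸ suc j) * fib j
        ≡⟨ cong₂ (λ i c → ê i + + c * fib j) (sym (shift (+ n) (+ s) (+ j))) (sym (ℕₚ.+-∸-assoc 1 j<s)) ⟩
      ê (+ suc n - + suc s + + j) + + (s ∸ j) * fib j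
        ≡⟨ cong (λ i → ê (+ suc n - + suc s + + j) + + (s ∸ j) * + F k i) (ℕₚ.+-suc n (r ℕ.+ j)) ⟩
      ê (+ suc n - + suc s + + j) + + (s ∸ j) * + F k (suc n ℕ.+ (r ℕ.+ j)) ∎
    last : ê (+ suc n - + suc s + + s) + + (s ∸ s) * + F k (suc n ℕ.+ (r ℕ.+ s)) ≡ + e k n
    last rewrite ℕₚ.n∸n≡0 s = trans (ℤₚ.+-identityʳ _) (cong ê (cancel (+ n) (+ s)))
      where
      cancel : ∀ n s → + 1 + n - (+ 1 + s) + s ≡ n
      cancel = solve-∀

  e-recurrence : ∀ n → + e k n ≡ Σℤ k (λ j → ê (+ n - + k + + j) + + (k' ∸ j) * + F k (n ℕ.+ j))
  e-recurrence n = trans (cong +_ (e≡weightSum-validLead n)) (weightSum-validLead n 0 k refl)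

module Operators (k' : ℕ) where

  open import Data.Integer.Base using (+_; -[1+_]; _+_; _*_; _-_)
  open SumProperties

  private
    k : ℕ
    k = suc k'

  κ : ℤ
  κ = + k

  L : (ℤ → ℤ) → ℤ → ℤ
  L z m = z (m + κ) - Σℤ k (λ j → z (m + + j))

  conv : (ℕ → ℤ) → (ℤ → ℤ) → ℤ → ℤ
  conv ζ z m = Σℤ k (λ j → ζ j * z (m + + j))

  Δ : (ℤ → ℤ) → ℤ → ℤ
  Δ z m = z (m + κ + 1ℤ) - + 2 * z (m + κ) + z m

  L-tail : ∀ z m → Σℤ k' (λ j → z (m + + suc j)) ≡ z (m + κ) - L z m - z m
  L-tail z m = begin
    tail                                          ≡⟨ cancel (z (m + κ)) (z m) tail ⟨
    z (m + κ) - (z (m + κ) - (z m + tail)) - z m  ≡⟨ cong (λ x → z (m + κ) - (z (m + κ) - x) - z m) head ⟨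
    z (m + κ) - L z m - z m                       ∎
    where
    open ≡-Reasoning
    tail : ℤ
    tail = Σℤ k' (λ j → z (m + + suc j))
    head : Σℤ k (λ j → z (m + + j)) ≡ z m + tail
    head = trans (Σℤ-head k' (λ j → z (m + + j))) (cong (λ x → z x + tail) (ℤₚ.+-identityʳ m))
    cancel : ∀ a b s → a - (a - (b + s)) - b ≡ s
    cancel = solve-∀

  conv-step : ∀ ζ η z m → conv ζ z (m + 1ℤ) - conv η z m
              ≡ ζ k' * z (m + κ) - η 0 * z m + Σℤ k' (λ j → (ζ j - η (suc j)) * z (m + + suc j))
  conv-step ζ η z m = begin
    conv ζ z (m + 1ℤ) - conv η z m
      ≡⟨ cong₂ _-_ (cong₂ _+_ (Σℤ-cong k' (λ {j} _ → cong (λ i → ζ j * z i) (ℤₚ.+-assoc m 1ℤ (+ j))))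
                              (cong (λ i → ζ k' * z i) (ℤₚ.+-assoc m 1ℤ (+ k'))))
                   (trans (Σℤ-head k' (λ j → η j * z (m + + j)))
                          (cong (λ i → η 0 * z i + Sη) (ℤₚ.+-identityʳ m))) ⟩
    (Sζ + ζ k' * z (m + κ)) - (η 0 * z m + Sη)
      ≡⟨ regroup Sζ (ζ k' * z (m + κ)) (η 0 * z m) Sη ⟩
    ζ k' * z (m + κ) - η 0 * z m + (Sζ - Sη)
      ≡⟨ cong (λ x → ζ k' * z (m + κ) - η 0 * z m + x)
              (sym (trans (Σℤ-cong k' (λ {j} _ → distrib (ζ j) (η (suc j)) (z (m + + suc j))))
                          (Σℤ-distrib-minus k' _ _))) ⟩
    ζ k' * z (m + κ) - η 0 * z m + Σℤ k' (λ j → (ζ j - η (suc j)) * z (m + + suc j)) ∎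
    where
    open ≡-Reasoning
    Sζ Sη : ℤ
    Sζ = Σℤ k' (λ j → ζ j * z (m + + suc j))
    Sη = Σℤ k' (λ j → η (suc j) * z (m + + suc j))
    regroup : ∀ s a b t → (s + a) - (b + t) ≡ a - b + (s - t)
    regroup = solve-∀
    distrib : ∀ a b x → (a - b) * x ≡ a * x - b * x
    distrib = solve-∀

  L-conv : ∀ ζ z m → L (conv ζ z) m ≡ conv ζ (L z) m
  L-conv ζ z m = sym (begin
    Σℤ k (λ j → ζ j * (z (m + + j + κ) - Σℤ k (λ i → z (m + + j + + i))))
      ≡⟨ Σℤ-cong k (λ {j} _ → trans (distrib (ζ j) _ _)
                                     (cong (λ x → ζ j * z (m + + j + κ) - x) (*-distribˡ-Σℤ (ζ j) k _))) ⟩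
    Σℤ k (λ j → ζ j * z (m + + j + κ) - Σℤ k (λ i → ζ j * z (m + + j + + i)))
      ≡⟨ Σℤ-distrib-minus k _ _ ⟩
    Σℤ k (λ j → ζ j * z (m + + j + κ)) - Σℤ k (λ j → Σℤ k (λ i → ζ j * z (m + + j + + i)))
      ≡⟨ cong₂ _-_ (Σℤ-cong k (λ {j} _ → cong (λ i → ζ j * z i) (swap m (+ j) κ)))
                   (trans (Σℤ-comm k k _)
                          (Σℤ-cong k (λ {i} _ → Σℤ-cong k (λ {j} _ → cong (λ x → ζ j * z x) (swap m (+ j) (+ i)))))) ⟩
    L (conv ζ z) m ∎)
    where
    open ≡-Reasoning
    distrib : ∀ a x y → a * (x - y) ≡ a * x - a * y
    distrib = solve-∀
    swap : ∀ m a b → m + a + b ≡ m + b + a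
    swap = solve-∀

  Δ≡L-step : ∀ z m → Δ z m ≡ L z (m + 1ℤ) - L z m
  Δ≡L-step z m = sym (begin
    L z (m + 1ℤ) - L z m
      ≡⟨ cong (λ s → z (m + 1ℤ + κ) - s - L z m) shifted-sum ⟩
    z (m + 1ℤ + κ) - (z (m + κ) - L z m - z m + z (m + κ)) - L z m
      ≡⟨ cong (λ i → z i - (z (m + κ) - L z m - z m + z (m + κ)) - L z m) (swap m 1ℤ κ) ⟩
    z (m + κ + 1ℤ) - (z (m + κ) - L z m - z m + z (m + κ)) - L z m
      ≡⟨ collect (z (m + κ + 1ℤ)) (z (m + κ)) (z m) (L z m) ⟩
    Δ z m ∎)
    where
    open ≡-Reasoning
    swap : ∀ m a b → m + a + b ≡ m + b + a
    swap = solve-∀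
    collect : ∀ a b c l → a - (b - l - c + b) - l ≡ a - + 2 * b + c
    collect = solve-∀
    shifted-sum : Σℤ k (λ j → z (m + 1ℤ + + j)) ≡ z (m + κ) - L z m - z m + z (m + κ)
    shifted-sum = cong₂ _+_ (trans (Σℤ-cong k' (λ {j} _ → cong z (ℤₚ.+-assoc m 1ℤ (+ j)))) (L-tail z m))
                            (cong z (ℤₚ.+-assoc m 1ℤ (+ k')))

  Δ-conv : ∀ ζ z m → Δ (conv ζ z) m ≡ conv ζ (L z) (m + 1ℤ) - conv ζ (L z) m
  Δ-conv ζ z m = trans (Δ≡L-step (conv ζ z) m) (cong₂ _-_ (L-conv ζ z (m + 1ℤ)) (L-conv ζ z m))

  *-conv : ∀ a ζ z m → a * conv ζ z m ≡ conv (λ j → a * ζ j) z m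
  *-conv a ζ z m = trans (*-distribˡ-Σℤ a k _) (Σℤ-cong k (λ {j} _ → sym (ℤₚ.*-assoc a (ζ j) (z (m + + j)))))

  conv-linear : ∀ a ζ η z m → a * conv ζ z m + conv η z m ≡ conv (λ j → a * ζ j + η j) z m
  conv-linear a ζ η z m =
    trans (cong (_+ conv η z m) (*-conv a ζ z m))
          (trans (sym (Σℤ-distrib-+ k _ _))
                 (Σℤ-cong k (λ {j} _ → sym (ℤₚ.*-distribʳ-+ (z (m + + j)) (a * ζ j) (η j)))))

  Δ-vanishing : ∀ (z : ℤ → ℤ) → (∀ q → z -[1+ q ] ≡ 0ℤ) → (∀ m → Δ z m ≡ 0ℤ) →
                ∀ n → z (+ n) ≡ 0ℤ
  Δ-vanishing z z<0≡0 Δz≡0 = <-rec _ step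
    where
    below : ∀ {n} → (∀ {q} → q < n → z (+ q) ≡ 0ℤ) → ∀ {m} → m ℤ.< + n → z m ≡ 0ℤ
    below ih {+ q}      q<n = ih (ℤₚ.drop‿+<+ q<n)
    below ih { -[1+ q ]} _  = z<0≡0 q
    step : ∀ n → (∀ {q} → q < n → z (+ q) ≡ 0ℤ) → z (+ n) ≡ 0ℤ
    step n ih = begin
      z (+ n)                        ≡⟨ cong z (restore (+ n) κ) ⟨
      z (p + κ + 1ℤ)                 ≡⟨ unfold (z (p + κ + 1ℤ)) (z (p + κ)) (z p) ⟩
      Δ z p + + 2 * z (p + κ) - z p  ≡⟨ cong₂ _-_ (cong₂ (λ x y → x + + 2 * y) (Δz≡0 p) (below ih p+κ<n))
                                                  (below ih p<n) ⟩
      0ℤ                             ∎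
      where
      open ≡-Reasoning
      p : ℤ
      p = + n - 1ℤ - κ
      n-1<n : + n - 1ℤ ℤ.< + n
      n-1<n = ℤₚ.m⊖1+n<m n 1
      restore : ∀ x κ → x - 1ℤ - κ + κ + 1ℤ ≡ x
      restore = solve-∀
      drop : ∀ x κ → x - 1ℤ - κ + κ ≡ x - 1ℤ
      drop = solve-∀
      p+κ<n : p + κ ℤ.< + n
      p+κ<n = subst (ℤ._< + n) (sym (drop (+ n) κ)) n-1<n
      p<n : p ℤ.< + n
      p<n = ℤₚ.≤-<-trans (ℤₚ.i≤j⇒i-k≤j κ ℤₚ.≤-refl) n-1<n
      unfold : ∀ a b c → a ≡ (a - + 2 * b + c) + + 2 * b - c
      unfold = solve-∀

module ClosedForm (k' : ℕ) where

  open import Data.Integer.Base using (+_; -[1+_]; _+_; _*_; _-_; -_)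
  open SumProperties
  open FibonacciProperties using (F-below; F-recurrence)
  open ZeroExtension
  open Recurrence k' using (ê; e-recurrence)
  open Operators k'

  private
    k : ℕ
    k = suc k'

  u : ℤ → ℤ
  u = extend (F k)

  u-below : ∀ {m} → m ℤ.< + k' → u m ≡ 0ℤ
  u-below {+ q}      q<k' = cong +_ (F-below k (ℤₚ.drop‿+<+ q<k'))
  u-below { -[1+ q ]} _   = refl

  conv-u-negative : ∀ ζ q → conv ζ u -[1+ q ] ≡ 0ℤ
  conv-u-negative ζ q = Σℤ-zero k (λ {j} j<k →
    trans (cong (ζ j *_) (u-below (ℤₚ.+-mono-<-≤ ℤ.-<+ (ℤ.+≤+ (ℕ.s≤s⁻¹ j<k))))) (ℤₚ.*-zeroʳ (ζ j)))

  L-u≡0 : ∀ m → m ≢ -1ℤ → L u m ≡ 0ℤ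
  L-u≡0 (+ n)           _    = ℤₚ.i≡j⇒i-j≡0 (F-recurrence k' n)
  L-u≡0 -[1+ 0 ]        m≢-1 = ⊥-elim (m≢-1 refl)
  L-u≡0 -[1+ suc q ]    _    = cong₂ _-_ (u-below (shifted ℕₚ.≤-refl))
                                         (Σℤ-zero k (λ j<k → u-below (shifted (ℕₚ.<⇒≤ j<k))))
    where
    shifted : ∀ {j} → j ≤ k → -[1+ suc q ] + + j ℤ.< + k'
    shifted j≤k = ℤₚ.+-mono-<-≤ (ℤ.-<- ℕ.z<s) (ℤ.+≤+ j≤k)

  L-u-annihilates : ∀ {a} p → (p ≡ -1ℤ → a ≡ 0ℤ) → a * L u p ≡ 0ℤ
  L-u-annihilates {a} p a≡0 with p ℤₚ.≟ -1ℤ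
  ... | yes p≡-1 = trans (cong (_* L u p) (a≡0 p≡-1)) (ℤₚ.*-zeroˡ (L u p))
  ... | no  p≢-1 = trans (cong (a *_) (L-u≡0 p p≢-1)) (ℤₚ.*-zeroʳ a)

  weights : ℕ → ℤ
  weights j = + (k' ∸ j)

  L-ê-shifted : ∀ n → L ê (+ n - κ) ≡ conv weights u (+ n)
  L-ê-shifted n = begin
    ê (+ n - κ + κ) - Σℤ k (λ j → ê (+ n - κ + + j))
      ≡⟨ cong (λ i → ê i - Σℤ k (λ j → ê (+ n - κ + + j))) (uncancel (+ n) κ) ⟩
    + e k n - Σℤ k (λ j → ê (+ n - κ + + j))
      ≡⟨ cong (_- Σℤ k (λ j → ê (+ n - κ + + j))) (trans (e-recurrence n) (Σℤ-distrib-+ k _ _)) ⟩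
    Σℤ k (λ j → ê (+ n - κ + + j)) + conv weights u (+ n) - Σℤ k (λ j → ê (+ n - κ + + j))
      ≡⟨ drop (Σℤ k (λ j → ê (+ n - κ + + j))) (conv weights u (+ n)) ⟩
    conv weights u (+ n) ∎
    where
    open ≡-Reasoning
    uncancel : ∀ m κ → m - κ + κ ≡ m
    uncancel = solve-∀
    drop : ∀ a b → a + b - a ≡ b
    drop = solve-∀

  L-ê : ∀ m → L ê m ≡ conv weights u (m + κ)
  L-ê m = by-sign (m + κ) refl
    where
    cancel : ∀ m κ → m + κ - κ ≡ m
    cancel = solve-∀
    by-sign : ∀ i → m + κ ≡ i → L ê m ≡ conv weights u (m + κ)
    by-sign (+ n)    m+κ≡n = begin
      L ê m                   ≡⟨ cong (L ê) (trans (sym (cancel m κ)) (cong (_- κ) m+κ≡n)) ⟩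
      L ê (+ n - κ)           ≡⟨ L-ê-shifted n ⟩
      conv weights u (+ n)    ≡⟨ cong (conv weights u) m+κ≡n ⟨
      conv weights u (m + κ)  ∎
      where open ≡-Reasoning
    by-sign -[1+ q ] m+κ≡-1-q = begin
      ê (m + κ) - Σℤ k (λ j → ê (m + + j))  ≡⟨ cong₂ _-_ (cong ê m+κ≡-1-q)
                                                       (Σℤ-zero k (λ j<k → extend-negative (e k) (below j<k))) ⟩
      0ℤ                                   ≡⟨ conv-u-negative weights q ⟨
      conv weights u -[1+ q ]              ≡⟨ cong (conv weights u) m+κ≡-1-q ⟨
      conv weights u (m + κ)               ∎
      where
      open ≡-Reasoning
      below : ∀ {j} → j < k → m + + j ℤ.< 0ℤ
      below j<k = ℤₚ.<-trans (subst (m + + _ ℤ.<_) m+κ≡-1-q (ℤₚ.+-monoʳ-< m (ℤ.+<+ j<k))) ℤ.-<+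

  weights-step : ∀ {j} → j < k' → weights j - weights (suc j) ≡ 1ℤ
  weights-step {j} j<k' =
    trans (cong (λ x → + x - weights (suc j)) (ℕₚ.+-∸-assoc 1 j<k')) (cancel (weights (suc j)))
    where
    cancel : ∀ x → + 1 + x - x ≡ 1ℤ
    cancel = solve-∀

  Δ-ê : ∀ m → Δ ê m ≡ u (m + κ + κ) - L u (m + κ) - κ * u (m + κ)
  Δ-ê m = begin
    Δ ê m
      ≡⟨ Δ≡L-step ê m ⟩
    L ê (m + 1ℤ) - L ê m
      ≡⟨ cong₂ _-_ (trans (L-ê (m + 1ℤ)) (cong (conv weights u) (swap m 1ℤ κ))) (L-ê m) ⟩
    conv weights u (n + 1ℤ) - conv weights u n
      ≡⟨ conv-step weights weights u n ⟩
    weights k' * u (n + κ) - + k' * u n + Σℤ k' (λ j → (weights j - weights (suc j)) * u (n + + suc j))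
      ≡⟨ cong₂ (λ w s → + w * u (n + κ) - + k' * u n + s) (ℕₚ.n∸n≡0 k')
               (Σℤ-cong k' (λ {j} j<k' → trans (cong (_* u (n + + suc j)) (weights-step j<k'))
                                               (ℤₚ.*-identityˡ (u (n + + suc j))))) ⟩
    0ℤ * u (n + κ) - + k' * u n + Σℤ k' (λ j → u (n + + suc j))
      ≡⟨ cong (λ s → 0ℤ * u (n + κ) - + k' * u n + s) (L-tail u n) ⟩
    0ℤ * u (n + κ) - + k' * u n + (u (n + κ) - L u n - u n)
      ≡⟨ collect (+ k') (u (n + κ)) (u n) (L u n) ⟩
    u (n + κ) - L u n - κ * u n ∎
    where
    open ≡-Reasoning
    n : ℤ
    n = m + κ
    swap : ∀ m a b → m + a + b ≡ m + b + a
    swap = solve-∀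
    collect : ∀ K a b l → 0ℤ * a - K * b + (a - l - b) ≡ a - l - (+ 1 + K) * b
    collect = solve-∀

  k+1 2k : ℕ
  k+1 = k ℕ.+ 1
  2k  = 2 ℕ.* k

  P Q c α β : ℤ
  P = + (k+1 ℕ.^ k)
  Q = + (2k ℕ.^ k)
  c = Q - κ * P
  α = κ + 1ℤ
  β = + 2 * κ

  g : ℕ → ℤ
  g j = + (k+1 ℕ.^ j ℕ.* 2k ℕ.^ (k ∸ j ∸ 1))

  A-decomposition : ∀ j → A k j ≡ c + + k' * g j
  A-decomposition j = cong₂ (λ x y → Q - x + y) (ℤₚ.pos-* k (k+1 ℕ.^ k))
    (trans (cong +_ (ℕₚ.*-assoc k' (k+1 ℕ.^ j) (2k ℕ.^ (k ∸ j ∸ 1))))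
           (ℤₚ.pos-* k' (k+1 ℕ.^ j ℕ.* 2k ℕ.^ (k ∸ j ∸ 1))))

  B-decomposition : ∀ j → B k j ≡ g j * (+ 3 * κ + + k' * + j - 1ℤ) - κ * P
  B-decomposition j = cong₂ _-_ (begin
      + (2k ℕ.^ (k ∸ j ∸ 1) ℕ.* k+1 ℕ.^ j ℕ.* (3 ℕ.* k ℕ.+ k' ℕ.* j ∸ 1))
        ≡⟨ ℤₚ.pos-* (2k ℕ.^ (k ∸ j ∸ 1) ℕ.* k+1 ℕ.^ j) (3 ℕ.* k ℕ.+ k' ℕ.* j ∸ 1) ⟩
      + (2k ℕ.^ (k ∸ j ∸ 1) ℕ.* k+1 ℕ.^ j) * + (3 ℕ.* k ℕ.+ k' ℕ.* j ∸ 1)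
        ≡⟨ cong₂ _*_ (cong +_ (ℕₚ.*-comm (2k ℕ.^ (k ∸ j ∸ 1)) (k+1 ℕ.^ j)))
                     (sym (ℤₚ.⊖-≥ (s≤s z≤n))) ⟩
      g j * (+ (3 ℕ.* k) + + (k' ℕ.* j) - 1ℤ)
        ≡⟨ cong (λ x → g j * (x - 1ℤ)) (cong₂ _+_ (ℤₚ.pos-* 3 k) (ℤₚ.pos-* k' j)) ⟩
      g j * (+ 3 * κ + + k' * + j - 1ℤ) ∎)
    (ℤₚ.pos-* k (k+1 ℕ.^ k))
    where open ≡-Reasoning

  D-decomposition : D k ≡ + 2 * Q - α * P
  D-decomposition = cong₂ _-_ (ℤₚ.pos-* 2 (2k ℕ.^ k))
    (trans (cong (λ i → + (k+1 ℕ.^ i)) (ℕₚ.+-comm k 1)) (ℤₚ.pos-* k+1 (k+1 ℕ.^ k)))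

  g-last : α * g k' ≡ P
  g-last = begin
    α * + (k+1 ℕ.^ k' ℕ.* 2k ℕ.^ (k ∸ k' ∸ 1))
      ≡⟨ cong (λ i → α * + (k+1 ℕ.^ k' ℕ.* 2k ℕ.^ (i ∸ 1))) (ℕₚ.m+n∸n≡m 1 k') ⟩
    α * + (k+1 ℕ.^ k' ℕ.* 1)
      ≡⟨ cong (λ x → α * + x) (ℕₚ.*-identityʳ _) ⟩
    α * + (k+1 ℕ.^ k')
      ≡⟨ ℤₚ.pos-* k+1 _ ⟨
    P ∎
    where open ≡-Reasoning

  g-first : β * g 0 ≡ Q
  g-first = begin
    β * + (1 ℕ.* 2k ℕ.^ k')   ≡⟨ cong₂ (λ x y → x * + y) (sym (ℤₚ.pos-* 2 k)) (ℕₚ.*-identityˡ _) ⟩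
    + 2k * + (2k ℕ.^ k') ≡⟨ ℤₚ.pos-* 2k _ ⟨
    Q ∎
    where open ≡-Reasoning

  g-step : ∀ {j} → j < k' → α * g j ≡ β * g (suc j)
  g-step {j} j<k' = begin
    α * g j
      ≡⟨ cong (λ i → α * + (k+1 ℕ.^ j ℕ.* 2k ℕ.^ i))
              (trans (exponent (ℕₚ.<⇒≤ j<k')) (ℕₚ.+-∸-assoc 1 j<k')) ⟩
    + k+1 * + (k+1 ℕ.^ j ℕ.* (2k ℕ.* 2k ℕ.^ r))
      ≡⟨ ℤₚ.pos-* k+1 _ ⟨
    + (k+1 ℕ.* (k+1 ℕ.^ j ℕ.* (2k ℕ.* 2k ℕ.^ r)))
      ≡⟨ cong +_ (rearrange k+1 2k (k+1 ℕ.^ j) (2k ℕ.^ r)) ⟩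
    + (2k ℕ.* (k+1 ℕ.* k+1 ℕ.^ j ℕ.* 2k ℕ.^ r))
      ≡⟨ ℤₚ.pos-* 2k _ ⟩
    + 2k * + (k+1 ℕ.* k+1 ℕ.^ j ℕ.* 2k ℕ.^ r)
      ≡⟨ cong₂ (λ x i → x * + (k+1 ℕ.* k+1 ℕ.^ j ℕ.* 2k ℕ.^ i)) (ℤₚ.pos-* 2 k) (exponent j<k') ⟨
    β * g (suc j) ∎
    where
    open ≡-Reasoning
    r : ℕ
    r = k' ∸ suc j
    exponent : ∀ {i} → i ≤ k' → k ∸ i ∸ 1 ≡ k' ∸ i
    exponent i≤k' = cong (_∸ 1) (ℕₚ.+-∸-assoc 1 i≤k')
    rearrange : ∀ a b x y → a ℕ.* (x ℕ.* (b ℕ.* y)) ≡ b ℕ.* (a ℕ.* x ℕ.* y)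
    rearrange = ℕ-Solver.solve-∀

  A-step : ∀ {j} → j < k' → α * A k j - β * A k (suc j) ≡ - (+ k' * c)
  A-step {j} j<k' = begin
    α * A k j - β * A k (suc j)
      ≡⟨ cong₂ (λ x y → α * x - β * y) (A-decomposition j) (A-decomposition (suc j)) ⟩
    α * (c + + k' * g j) - β * (c + + k' * g (suc j))
      ≡⟨ expand (+ k') c (g j) (g (suc j)) ⟩
    - (+ k' * c) + + k' * (α * g j - β * g (suc j))
      ≡⟨ cong (λ x → - (+ k' * c) + + k' * x) (ℤₚ.i≡j⇒i-j≡0 (g-step j<k')) ⟩
    - (+ k' * c) + + k' * 0ℤ
      ≡⟨ cong (λ x → - (+ k' * c) + x) (ℤₚ.*-zeroʳ (+ k')) ⟩
    - (+ k' * c) + 0ℤ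
      ≡⟨ ℤₚ.+-identityʳ _ ⟩
    - (+ k' * c) ∎
    where
    open ≡-Reasoning
    expand : ∀ K c x y → (+ 1 + K + 1ℤ) * (c + K * x) - + 2 * (+ 1 + K) * (c + K * y)
                       ≡ - (K * c) + K * ((+ 1 + K + 1ℤ) * x - + 2 * (+ 1 + K) * y)
    expand = solve-∀

  A-last : α * A k k' ≡ α * c + + k' * P
  A-last = trans (cong (α *_) (A-decomposition k'))
                 (trans (expand α c (+ k') (g k')) (cong (λ x → α * c + + k' * x) g-last))
    where
    expand : ∀ a c K x → a * (c + K * x) ≡ a * c + K * (a * x)
    expand = solve-∀

  A-first : β * A k 0 ≡ β * c + + k' * Q
  A-first = trans (cong (β *_) (A-decomposition 0))
                  (trans (expand β c (+ k') (g 0)) (cong (λ x → β * c + + k' * x) g-first))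
    where
    expand : ∀ a c K x → a * (c + K * x) ≡ a * c + K * (a * x)
    expand = solve-∀

  X Y : ℤ → ℤ
  X = conv (A k) u
  Y = conv (B k) u

  X-transfer : ∀ n → α * X (n + 1ℤ) - β * X n ≡ D k * (u (n + κ) - κ * u n) + + k' * c * L u n
  X-transfer n = begin
    α * X (n + 1ℤ) - β * X n
      ≡⟨ cong₂ _-_ (*-conv α (A k) u (n + 1ℤ)) (*-conv β (A k) u n) ⟩
    conv (λ j → α * A k j) u (n + 1ℤ) - conv (λ j → β * A k j) u n
      ≡⟨ conv-step (λ j → α * A k j) (λ j → β * A k j) u n ⟩
    α * A k k' * u (n + κ) - β * A k 0 * u n + steps
      ≡⟨ cong₂ (λ x y → x * u (n + κ) - y * u n + steps) A-last A-first ⟩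
    (α * c + + k' * P) * u (n + κ) - (β * c + + k' * Q) * u n + steps
      ≡⟨ cong (λ s → (α * c + + k' * P) * u (n + κ) - (β * c + + k' * Q) * u n + s) steps≡ ⟩
    (α * c + + k' * P) * u (n + κ) - (β * c + + k' * Q) * u n - + k' * c * (u (n + κ) - L u n - u n)
      ≡⟨ collect (+ k') Q P (u (n + κ)) (u n) (L u n) ⟩
    (+ 2 * Q - α * P) * (u (n + κ) - κ * u n) + + k' * c * L u n
      ≡⟨ cong (λ d → d * (u (n + κ) - κ * u n) + + k' * c * L u n) D-decomposition ⟨
    D k * (u (n + κ) - κ * u n) + + k' * c * L u n ∎
    where
    open ≡-Reasoning
    steps : ℤ
    steps = Σℤ k' (λ j → (α * A k j - β * A k (suc j)) * u (n + + suc j))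
    steps≡ : steps ≡ - (+ k' * c * (u (n + κ) - L u n - u n))
    steps≡ = begin
      steps
        ≡⟨ Σℤ-cong k' (λ {j} j<k' → cong (_* u (n + + suc j)) (A-step j<k')) ⟩
      Σℤ k' (λ j → - (+ k' * c) * u (n + + suc j))
        ≡⟨ *-distribˡ-Σℤ (- (+ k' * c)) k' (λ j → u (n + + suc j)) ⟨
      - (+ k' * c) * Σℤ k' (λ j → u (n + + suc j))
        ≡⟨ cong (- (+ k' * c) *_) (L-tail u n) ⟩
      - (+ k' * c) * (u (n + κ) - L u n - u n)
        ≡⟨ ℤₚ.neg-distribˡ-* (+ k' * c) _ ⟨
      - (+ k' * c * (u (n + κ) - L u n - u n)) ∎
    collect : ∀ K Q P u₁ u₀ l →
      let κ = + 1 + K ; α = κ + 1ℤ ; β = + 2 * κ ; c = Q - κ * P in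
      (α * c + K * P) * u₁ - (β * c + K * Q) * u₀ - K * c * (u₁ - l - u₀)
        ≡ (+ 2 * Q - α * P) * (u₁ - κ * u₀) + K * c * l
    collect = solve-∀

  coeff : ℤ → ℕ → ℤ
  coeff m j = m * A k j + B k j

  coefficient-last : D k + + k' * c + coeff (-1ℤ - κ) k' ≡ 0ℤ
  coefficient-last = begin
    D k + + k' * c + coeff (-1ℤ - κ) k'
      ≡⟨ cong (λ d → d + + k' * c + coeff (-1ℤ - κ) k') D-decomposition ⟩
    + 2 * Q - α * P + + k' * c + coeff (-1ℤ - κ) k'
      ≡⟨ cong₂ (λ a b → + 2 * Q - α * P + + k' * c + ((-1ℤ - κ) * a + b))
               (A-decomposition k') (B-decomposition k') ⟩
    + 2 * Q - α * P + + k' * c + ((-1ℤ - κ) * (c + + k' * g k') + (g k' * (+ 3 * κ + + k' * + k' - 1ℤ) - κ * P))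
      ≡⟨ collect (+ k') Q P (g k') ⟩
    α * g k' - P
      ≡⟨ ℤₚ.i≡j⇒i-j≡0 g-last ⟩
    0ℤ ∎
    where
    open ≡-Reasoning
    collect : ∀ K Q P x →
      let κ = + 1 + K ; α = κ + 1ℤ ; c = Q - κ * P in
      + 2 * Q - α * P + K * c + ((-1ℤ - κ) * (c + K * x) + (x * (+ 3 * κ + K * K - 1ℤ) - κ * P)) ≡ α * x - P
    collect = solve-∀

  coefficient-first : coeff -1ℤ 0 ≡ 0ℤ
  coefficient-first = begin
    coeff -1ℤ 0
      ≡⟨ cong₂ (λ a b → -1ℤ * a + b) (A-decomposition 0) (B-decomposition 0) ⟩
    -1ℤ * (c + + k' * g 0) + (g 0 * (+ 3 * κ + + k' * + 0 - 1ℤ) - κ * P)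
      ≡⟨ collect (+ k') Q P (g 0) ⟩
    β * g 0 - Q
      ≡⟨ ℤₚ.i≡j⇒i-j≡0 g-first ⟩
    0ℤ ∎
    where
    open ≡-Reasoning
    collect : ∀ K Q P x →
      let κ = + 1 + K ; β = + 2 * κ ; c = Q - κ * P in
      -1ℤ * (c + K * x) + (x * (+ 3 * κ + K * + 0 - 1ℤ) - κ * P) ≡ β * x - Q
    collect = solve-∀

  coefficient-step : ∀ {j} → j < k' → coeff (-1ℤ - + suc j) j - coeff (-1ℤ - + suc j) (suc j) ≡ 0ℤ
  coefficient-step {j} j<k' = begin
    coeff m j - coeff m (suc j)
      ≡⟨ cong₂ (λ x y → x - y) (cong₂ (λ a b → m * a + b) (A-decomposition j) (B-decomposition j))
                                (cong₂ (λ a b → m * a + b) (A-decomposition (suc j)) (B-decomposition (suc j))) ⟩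
    (m * (c + + k' * g j) + (g j * (+ 3 * κ + + k' * + j - 1ℤ) - κ * P))
      - (m * (c + + k' * g (suc j)) + (g (suc j) * (+ 3 * κ + + k' * + suc j - 1ℤ) - κ * P))
      ≡⟨ collect (+ k') (+ j) Q P (g j) (g (suc j)) ⟩
    α * g j - β * g (suc j)
      ≡⟨ ℤₚ.i≡j⇒i-j≡0 (g-step j<k') ⟩
    0ℤ ∎
    where
    open ≡-Reasoning
    m : ℤ
    m = -1ℤ - + suc j
    collect : ∀ K J Q P x y →
      let κ = + 1 + K ; α = κ + 1ℤ ; β = + 2 * κ ; c = Q - κ * P ; m = -1ℤ - (+ 1 + J) in
      (m * (c + K * x) + (x * (+ 3 * κ + K * J - 1ℤ) - κ * P))
        - (m * (c + K * y) + (y * (+ 3 * κ + K * (+ 1 + J) - 1ℤ) - κ * P))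
        ≡ α * x - β * y
    collect = solve-∀

  Ψ : ℤ → ℤ
  Ψ m = D k * ê m - (m * X m + Y m)

  Δ-Ψ : ∀ m → Δ Ψ m
              ≡ - ((D k + + k' * c) * L u (m + κ)) - (conv (coeff m) (L u) (m + 1ℤ) - conv (coeff m) (L u) m)
  Δ-Ψ m = begin
    Δ Ψ m
      ≡⟨ expand (D k) m κ (ê (n + 1ℤ)) (ê n) (ê m) (X (n + 1ℤ)) (X n) (X m) (Y (n + 1ℤ)) (Y n) (Y m) ⟩
    D k * Δ ê m - m * Δ X m - (α * X (n + 1ℤ) - β * X n) - Δ Y m
      ≡⟨ cong₂ (λ x y → D k * x - m * y - (α * X (n + 1ℤ) - β * X n) - Δ Y m) (Δ-ê m) (Δ-conv (A k) u m) ⟩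
    D k * (u (n + κ) - L u n - κ * u n) - m * (a₁ - a₀) - (α * X (n + 1ℤ) - β * X n) - Δ Y m
      ≡⟨ cong₂ (λ x y → D k * (u (n + κ) - L u n - κ * u n) - m * (a₁ - a₀) - x - y)
               (X-transfer n) (Δ-conv (B k) u m) ⟩
    D k * (u (n + κ) - L u n - κ * u n) - m * (a₁ - a₀)
      - (D k * (u (n + κ) - κ * u n) + + k' * c * L u n) - (b₁ - b₀)
      ≡⟨ collect (D k) m (+ k' * c) (u (n + κ)) (u n) κ (L u n) a₁ a₀ b₁ b₀ ⟩
    - ((D k + + k' * c) * L u n) - ((m * a₁ + b₁) - (m * a₀ + b₀))
      ≡⟨ cong₂ (λ x y → - ((D k + + k' * c) * L u n) - (x - y))
               (conv-linear m (A k) (B k) (L u) (m + 1ℤ)) (conv-linear m (A k) (B k) (L u) m) ⟩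
    - ((D k + + k' * c) * L u n) - (conv (coeff m) (L u) (m + 1ℤ) - conv (coeff m) (L u) m) ∎
    where
    open ≡-Reasoning
    n a₁ a₀ b₁ b₀ : ℤ
    n  = m + κ
    a₁ = conv (A k) (L u) (m + 1ℤ)
    a₀ = conv (A k) (L u) m
    b₁ = conv (B k) (L u) (m + 1ℤ)
    b₀ = conv (B k) (L u) m
    expand : ∀ d m κ e₁ e₀ e x₁ x₀ x y₁ y₀ y →
      (d * e₁ - ((m + κ + 1ℤ) * x₁ + y₁)) - + 2 * (d * e₀ - ((m + κ) * x₀ + y₀)) + (d * e - (m * x + y))
        ≡ d * (e₁ - + 2 * e₀ + e) - m * (x₁ - + 2 * x₀ + x) - ((κ + 1ℤ) * x₁ - + 2 * κ * x₀)
          - (y₁ - + 2 * y₀ + y)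
    expand = solve-∀
    collect : ∀ d m kc u₁ u₀ κ l a₁ a₀ b₁ b₀ →
      d * (u₁ - l - κ * u₀) - m * (a₁ - a₀) - (d * (u₁ - κ * u₀) + kc * l) - (b₁ - b₀)
        ≡ - ((d + kc) * l) - ((m * a₁ + b₁) - (m * a₀ + b₀))
    collect = solve-∀

  Δ-Ψ≡0 : ∀ m → Δ Ψ m ≡ 0ℤ
  Δ-Ψ≡0 m = begin
    Δ Ψ m
      ≡⟨ Δ-Ψ m ⟩
    - ((D k + + k' * c) * L u (m + κ)) - (conv (coeff m) (L u) (m + 1ℤ) - conv (coeff m) (L u) m)
      ≡⟨ cong (λ x → - ((D k + + k' * c) * L u (m + κ)) - x) (conv-step (coeff m) (coeff m) (L u) m) ⟩
    - ((D k + + k' * c) * L u (m + κ)) - (coeff m k' * L u (m + κ) - coeff m 0 * L u m + steps)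
      ≡⟨ collect (D k + + k' * c) (coeff m k') (coeff m 0) (L u (m + κ)) (L u m) steps ⟩
    - ((D k + + k' * c + coeff m k') * L u (m + κ)) + coeff m 0 * L u m - steps
      ≡⟨ cong₂ _-_ (cong₂ (λ x y → - x + y) last first) (Σℤ-zero k' step) ⟩
    0ℤ ∎
    where
    open ≡-Reasoning
    steps : ℤ
    steps = Σℤ k' (λ j → (coeff m j - coeff m (suc j)) * L u (m + + suc j))
    collect : ∀ d a b l₁ l₀ s → - (d * l₁) - (a * l₁ - b * l₀ + s) ≡ - ((d + a) * l₁) + b * l₀ - s
    collect = solve-∀
    solve-for : ∀ {x y} → m + x ≡ y → m ≡ y - x
    solve-for {x} {y} m+x≡y = trans (sym (cancel m x)) (cong (_- x) m+x≡y)
      where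
      cancel : ∀ m x → m + x - x ≡ m
      cancel = solve-∀
    last : (D k + + k' * c + coeff m k') * L u (m + κ) ≡ 0ℤ
    last = L-u-annihilates (m + κ) (λ m+κ≡-1 →
      subst (λ x → D k + + k' * c + coeff x k' ≡ 0ℤ) (sym (solve-for m+κ≡-1)) coefficient-last)
    first : coeff m 0 * L u m ≡ 0ℤ
    first = L-u-annihilates m (λ m≡-1 → subst (λ x → coeff x 0 ≡ 0ℤ) (sym m≡-1) coefficient-first)
    step : ∀ {j} → j < k' → (coeff m j - coeff m (suc j)) * L u (m + + suc j) ≡ 0ℤ
    step {j} j<k' = L-u-annihilates (m + + suc j) (λ m+j+1≡-1 →
      subst (λ x → coeff x j - coeff x (suc j) ≡ 0ℤ) (sym (solve-for m+j+1≡-1)) (coefficient-step j<k'))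

  Ψ-negative : ∀ q → Ψ -[1+ q ] ≡ 0ℤ
  Ψ-negative q =
    trans (cong₂ (λ x y → D k * 0ℤ - (-[1+ q ] * x + y)) (conv-u-negative (A k) q) (conv-u-negative (B k) q))
          (vanish (D k) -[1+ q ])
    where
    vanish : ∀ d m → d * 0ℤ - (m * 0ℤ + 0ℤ) ≡ 0ℤ
    vanish = solve-∀

  closed-form : ∀ n → D k * + e k n ≡ Σℤ k (λ j → (+ n * A k j + B k j) * + F k (n ℕ.+ j))
  closed-form n = begin
    D k * + e k n               ≡⟨ ℤₚ.i-j≡0⇒i≡j _ _ (Δ-vanishing Ψ Ψ-negative Δ-Ψ≡0 n) ⟩
    + n * X (+ n) + Y (+ n)     ≡⟨ conv-linear (+ n) (A k) (B k) u (+ n) ⟩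
    conv (coeff (+ n)) u (+ n)  ∎
    where open ≡-Reasoning

open import Data.Nat.Base using (_+_)
open import Data.Integer using (+_; _*_)

theorem3p6 : (n k : ℕ) → 2 ≤ k → k ≤ n →
    D k * (+ e k n) ≡ Σℤ k (λ j → ((+ n) * A k j Data.Integer.+ B k j) * (+ F k (n + j)))
theorem3p6 n (suc k') _ _ = ClosedForm.closed-form k' n
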